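{- Let $c$ be a Coxeter element of $\widehat{\mathfrak S}_n$. For every $c$-sortable TITO $\prec$ on $\mathbb Z$, the diagram $\widetilde{\mathrm{ncad}}(\prec)$ is a cyclic $c$-noncrossing arc diagram.
   Context: $c$ is a product, once each, of the simple generators $s_i$ ($0\le i\le n-1$, exchanging $i+mn$ and $i+1+mn$) of $\widehat{\mathfrak S}_n$; it moves every integer; $\overline{L_c}=\{x:c(x)>x\}$, $\overline{R_c}=\{x:c(x)<x\}$. A (real) TITO is a total order $\prec$ on $\mathbb Z$ with $x\prec y\iff x+n\prec y+n$ and no cover relation $x+n\prec x$; blocks are classes of the equivalence "finitely many elements $\prec$-between", which are $\prec$-intervals, unions of residue classes, linearly ordered; waning if $x+n\prec x$ on the block, waxing otherwise. $\prec$ is $c$-sortable if (1) either it is a single waxing block, or its blocks are, in order, possibly a waxing block $\subseteq\overline{L_c}$, a waning block meeting $\overline{L_c}$ and $\overline{R_c}$, possibly a waxing block $\subseteq\overline{R_c}$, and no others; (2) no $i<j<k$ with $k\prec i\prec j$, $j\in\overline{L_c}$, nor $j\prec k\prec i$, $j\in\overline{R_c}$. For a TITO $\prec$ with no two consecutive waxing blocks, $\widetilde{\mathrm{ncad}}(\prec)$ is the set of arcs $(p,q,L,R)$ over all $p<q$ with $p\not\equiv q\pmod n$ and $q$ the immediate predecessor of $p$ in $\prec$, where $L=\{i: p<i<q,\ i\prec q\}$ and $R=\{i:p<i<q,\ p\prec i\}$; by Barkley's results this is a cyclic noncrossing arc diagram. Arcs and crossing: an arc is $(p,q,L,R)$,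 $p<q$, $p\not\equiv q$, $L\sqcup R=\{p+1,\dots,q-1\}$; distinct arcs $(p,q,L,R),(p',q',L',R')$ cross iff $((L\cup\{p,q\})\cap R')\cup(L\cap\{p',q'\})\ne\emptyset$ and $(R\cap(L'\cup\{p',q'\}))\cup(\{p,q\}\cap L')\ne\emptyset$. A cyclic noncrossing arc diagram is an $n$-translation-invariant set of pairwise noncrossing arcs with no two sharing an initial point or a final point. A loop is a bi-infinite sequence of arcs $(\alpha_i)_{i\in\mathbb Z}$ in the diagram with the final point of $\alpha_i$ equal to the initial point of $\alpha_{i+1}$; it is real if its set of endpoints meets both $\overline{L_c}$ and $\overline{R_c}$. A cyclic $c$-noncrossing arc diagram is a cyclic noncrossing arc diagram in which every arc $(p,q,L,R)$ has $L\subseteq\overline{L_c}$, $R\subseteq\overline{R_c}$, and every loop is real. -}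

module Defs where

open import Level using (0ℓ)
open import Data.Nat as ℕ using (ℕ; NonZero)
open import Data.Integer.Base using (ℤ; +_; -_; _+_; _-_; _<_; _%ℕ_)
open import Data.Fin using (Fin; toℕ)
open import Data.List using (List; foldr)
open import Data.List.Membership.Propositional using (_∈_)
open import Data.Product using (Σ; ∃; _×_; _,_)
open import Data.Sum using (_⊎_)
open import Data.Empty using (⊥)
open import Relation.Nullary using (¬_; yes; no)
open import Relation.Binary.PropositionalEquality using (_≡_)
open import Relation.Binary.Structures using (IsStrictTotalOrder)

_≡[mod_]_ : ℤ → (n : ℕ) .{{_ : NonZero n}} → ℤ → Set
x ≡[mod n ] y = x %ℕ n ≡ y %ℕ n

-- s_i (i ∈ {0,…,n-1}) exchanges i+mn and i+1+mn for every m ∈ ℤ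
-- (meaningful for n ≥ 2).
s : (n : ℕ) .{{_ : NonZero n}} → Fin n → ℤ → ℤ
s n i x with x %ℕ n ℕ.≟ toℕ i
... | yes _ = x + + 1
... | no _ with x %ℕ n ℕ.≟ (ℕ.suc (toℕ i)) ℕ.% n
...   | yes _ = x - + 1
...   | no _ = x

-- The product s_{w₀} s_{w₁} ⋯ s_{w_k} as a permutation of ℤ
-- (rightmost factor acts first).  A Coxeter element is such a product
-- where w lists each index 0,…,n-1 exactly once (w ↭ allFin n).
prod : (n : ℕ) .{{_ : NonZero n}} → List (Fin n) → ℤ → ℤ
prod n w x = foldr (λ i y → s n i y) x w

Lc : (n : ℕ) .{{_ : NonZero n}} → List (Fin n) → ℤ → Set
Lc n w x = x < prod n w x

Rc : (n : ℕ) .{{_ : NonZero n}} → List (Fin n) → ℤ → Set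
Rc n w x = prod n w x < x

module _ (_≺_ : ℤ → ℤ → Set) where

  Cover : ℤ → ℤ → Set
  Cover a b = a ≺ b × (∀ z → ¬ (a ≺ z × z ≺ b))

  Between : ℤ → ℤ → ℤ → Set
  Between x y z = (x ≺ z × z ≺ y) ⊎ (y ≺ z × z ≺ x)

  SameBlock : ℤ → ℤ → Set
  SameBlock x y = Σ (List ℤ) λ l → ∀ z → Between x y z → z ∈ l

record IsTITO (n : ℕ) (_≺_ : ℤ → ℤ → Set) : Set where
  field
    isStrictTotalOrder : IsStrictTotalOrder _≡_ _≺_
    shift-inv  : ∀ x y → x ≺ y → (x + + n) ≺ (y + + n)
    shift-inv⁻ : ∀ x y → (x + + n) ≺ (y + + n) → x ≺ y
    noCover    : ∀ x → ¬ Cover _≺_ (x + + n) x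

module _ (n : ℕ) (_≺_ : ℤ → ℤ → Set) where

  Waning : ℤ → Set
  Waning x = (x + + n) ≺ x

  Waxing : ℤ → Set
  Waxing x = x ≺ (x + + n)

module _ (n : ℕ) .{{_ : NonZero n}} (w : List (Fin n)) (_≺_ : ℤ → ℤ → Set) where

  SingleWaxingBlock : Set
  SingleWaxingBlock = (∀ x y → SameBlock _≺_ x y) × (∀ x → Waxing n _≺_ x)

  -- Condition (1), second alternative: the block of b is waning and meets
  -- L_c and R_c; all elements ≺-before that block form at most one block,
  -- which is waxing and contained in L_c; all elements ≺-after it form at
  -- most one block, which is waxing and contained in R_c; no other blocks.
  ThreeBlocks : Set
  ThreeBlocks = Σ ℤ λ b →
      (∀ x → SameBlock _≺_ x b → Waning n _≺_ x)
    × (∃ λ x → SameBlock _≺_ x b × Lc n w x)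
    × (∃ λ y → SameBlock _≺_ y b × Rc n w y)
    × (∀ x → ¬ SameBlock _≺_ x b → x ≺ b → Waxing n _≺_ x × Lc n w x)
    × (∀ x y → ¬ SameBlock _≺_ x b → ¬ SameBlock _≺_ y b → x ≺ b → y ≺ b
         → SameBlock _≺_ x y)
    × (∀ x → ¬ SameBlock _≺_ x b → b ≺ x → Waxing n _≺_ x × Rc n w x)
    × (∀ x y → ¬ SameBlock _≺_ x b → ¬ SameBlock _≺_ y b → b ≺ x → b ≺ y
         → SameBlock _≺_ x y)

  Sortable1 : Set
  Sortable1 = SingleWaxingBlock ⊎ ThreeBlocks

  Sortable2 : Set
  Sortable2 =
      ¬ (Σ ℤ λ i → Σ ℤ λ j → Σ ℤ λ k →
           i < j × j < k × k ≺ i × i ≺ j × Lc n w j)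
    × ¬ (Σ ℤ λ i → Σ ℤ λ j → Σ ℤ λ k →
           i < j × j < k × j ≺ k × k ≺ i × Rc n w j)

  CSortable : Set
  CSortable = Sortable1 × Sortable2

record Arc : Set₁ where
  constructor arc
  field
    p q : ℤ
    L R : ℤ → Set
open Arc public

IsArc : (n : ℕ) .{{_ : NonZero n}} → Arc → Set
IsArc n α =
    p α < q α
  × ¬ (p α ≡[mod n ] q α)
  × (∀ i → L α i → p α < i × i < q α)
  × (∀ i → R α i → p α < i × i < q α)
  × (∀ i → p α < i → i < q α → L α i ⊎ R α i)
  × (∀ i → L α i → R α i → ⊥)

shiftArc : ℤ → Arc → Arc
shiftArc k α = arc (p α + k) (q α + k) (λ i → L α (i - k)) (λ i → R α (i - k))

ArcEq : Arc → Arc → Set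
ArcEq α β = p α ≡ p β × q α ≡ q β
          × (∀ i → (L α i → L β i) × (L β i → L α i))
          × (∀ i → (R α i → R β i) × (R β i → R α i))

Crosses : Arc → Arc → Set
Crosses α β =
    ( (∃ λ i → (L α i ⊎ i ≡ p α ⊎ i ≡ q α) × R β i)
    ⊎ (∃ λ i → L α i × (i ≡ p β ⊎ i ≡ q β)) )
  × ( (∃ λ i → R α i × (L β i ⊎ i ≡ p β ⊎ i ≡ q β))
    ⊎ (∃ λ i → (i ≡ p α ⊎ i ≡ q α) × L β i) )

-- Pairwise noncrossing is asked for all pairs: an arc never crosses
-- itself, so this is the same as asking it for distinct pairs.
IsCyclicNCAD : (n : ℕ) .{{_ : NonZero n}} → (Arc → Set) → Set₁
IsCyclicNCAD n D =
    (∀ α → D α → IsArc n α)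
  × (∀ α → D α → D (shiftArc (+ n) α) × D (shiftArc (- (+ n)) α))
  × (∀ α β → D α → D β → ¬ Crosses α β)
  × (∀ α β → D α → D β → p α ≡ p β → ArcEq α β)
  × (∀ α β → D α → D β → q α ≡ q β → ArcEq α β)

record Loop (D : Arc → Set) : Set₁ where
  field
    seq  : ℤ → Arc
    mem  : ∀ i → D (seq i)
    link : ∀ i → q (seq i) ≡ p (seq (i + + 1))
open Loop public

module _ (n : ℕ) .{{_ : NonZero n}} (w : List (Fin n)) where

  RealLoop : {D : Arc → Set} → Loop D → Set
  RealLoop ℓ =
      (∃ λ i → Lc n w (p (seq ℓ i)) ⊎ Lc n w (q (seq ℓ i)))
    × (∃ λ i → Rc n w (p (seq ℓ i)) ⊎ Rc n w (q (seq ℓ i)))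

  IsCyclicCNCAD : (Arc → Set) → Set₁
  IsCyclicCNCAD D =
      IsCyclicNCAD n D
    × (∀ α → D α → ∀ i → L α i → Lc n w i)
    × (∀ α → D α → ∀ i → R α i → Rc n w i)
    × ((ℓ : Loop D) → RealLoop ℓ)

ncad : (n : ℕ) .{{_ : NonZero n}} → (ℤ → ℤ → Set) → Arc → Set
ncad n _≺_ α =
    p α < q α
  × ¬ (p α ≡[mod n ] q α)
  × Cover _≺_ (q α) (p α)
  × (∀ i → (L α i → p α < i × i < q α × i ≺ q α)
         × (p α < i × i < q α × i ≺ q α → L α i))
  × (∀ i → (R α i → p α < i × i < q α × p α ≺ i)
         × (p α < i × i < q α × p α ≺ i → R α i))

-- ncad(≺) joins each p to its immediate ≺-predecessor q, so an arc is determined by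
-- either endpoint, and two crossing arcs would force two nested covers; translation
-- invariance of ≺ makes the diagram n-periodic.  A Coxeter element moves every integer
-- (under distinct simple generators x can never return to itself), so condition (2)
-- of c-sortability forces L ⊆ L_c and R ⊆ R_c.  The vertices of a loop increase in ℤ
-- and form a ≺-descending chain of covers; two of them agree modulo n, so the chain
-- runs from some vertex v down to T v, T a translation by a positive multiple of n,
-- passing through everything ≺-between T v and v.  Hence v is not waxing and lies in
-- the waning block, and a witness of L_c (resp. R_c) in that block, translated by a
-- power of T into the window between T v and v, is a vertex of the loop.
module Submission where

open import Defs
open import Data.Nat as ℕ using (ℕ; NonZero; zero; suc; _≤_; _≤′_; ≤′-refl; ≤′-step)
import Data.Nat.Properties as ℕP
open import Data.Nat.Properties using (anyUpTo?)
import Data.Nat.DivMod as ℕD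
open import Data.Integer.Base as ℤ using (ℤ; +_; -[1+_]; _+_; _-_; -_; _*_; _<_; _%ℕ_; _/ℕ_)
import Data.Integer.Properties as ℤP
open import Data.Integer.DivMod using (n%ℕd<d; a≡a%ℕn+[a/ℕn]*n)
open import Data.Integer.Tactic.RingSolver using (solve-∀)
open import Data.List using (List; []; _∷_; _++_; allFin; length; lookup)
open import Data.List.Membership.Propositional using (_∈_; _∉_)
open import Data.List.Membership.Propositional.Properties using (∈-allFin; ∈-++⁺ˡ; ∈-++⁺ʳ)
open import Data.List.Relation.Unary.Any as Any using (here; there)
open import Data.List.Relation.Unary.Any.Properties using (lookup-index)
open import Data.List.Relation.Unary.All.Properties using (All¬⇒¬Any)
open import Data.List.Relation.Unary.AllPairs using ([]; _∷_)
open import Data.List.Relation.Unary.Unique.Propositional using (Unique)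
open import Data.List.Relation.Unary.Unique.Propositional.Properties using (allFin⁺)
open import Data.List.Relation.Binary.Permutation.Propositional using (_↭_; ↭-sym; ↭⇒↭ₛ)
open import Data.List.Relation.Binary.Permutation.Propositional.Properties using (∈-resp-↭)
open import Data.List.Relation.Binary.Permutation.Setoid.Properties using (Unique-resp-↭)
open import Data.Fin as Fin using (Fin; toℕ; fromℕ<)
import Data.Fin.Properties as FinP
open import Data.Empty using (⊥; ⊥-elim)
open import Data.Sum as Sum using (_⊎_; inj₁; inj₂; [_,_]′)
open import Data.Product as Product using (Σ; ∃; _×_; _,_; proj₁; proj₂; swap)
open import Relation.Binary.PropositionalEquality as ≡
open import Relation.Binary.Definitions using (tri<; tri≈; tri>)
open import Relation.Nullary using (¬_; yes; no)
open import Relation.Nullary.Decidable using (decidable-stable; ¬¬-excluded-middle)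
open import Relation.Unary using (Decidable)
open import Relation.Binary.Structures using (IsStrictTotalOrder)
import Relation.Binary.Construct.Flip.EqAndOrd as Flip
open import Function using (id; _∘_; flip; _⇔_; mk⇔; Equivalence)
open import Function.Construct.Composition using (_⇔-∘_)
open import Data.Product.Function.NonDependent.Propositional using (_×-⇔_)
open import Algebra.Properties.AbelianGroup ℤP.+-0-abelianGroup using (∙-cancelʳ)

[i-k]+k≡i : ∀ i k → i - k + k ≡ i
[i-k]+k≡i = solve-∀

[i+k]-k≡i : ∀ i k → i + k - k ≡ i
[i+k]-k≡i = solve-∀

r+q*m+m≡r+[1+q]*m : ∀ r q m → r + q * m + m ≡ r + (+ 1 + q) * m
r+q*m+m≡r+[1+q]*m = solve-∀

r+q*m+1≡[1+r]+q*m : ∀ r q m → r + q * m + + 1 ≡ + 1 + r + q * m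
r+q*m+1≡[1+r]+q*m = solve-∀

m+q*m≡0+[1+q]*m : ∀ q m → m + q * m ≡ + 0 + (+ 1 + q) * m
m+q*m≡0+[1+q]*m = solve-∀

i+j+k≡i+k+j : ∀ i j k → i + j + k ≡ i + k + j
i+j+k≡i+k+j = solve-∀

i+m+q*m≡i+[1+q]*m : ∀ i q m → i + m + q * m ≡ i + (+ 1 + q) * m
i+m+q*m≡i+[1+q]*m = solve-∀

r+b*m≡r+a*m+[b-a]*m : ∀ r a b m → r + b * m ≡ r + a * m + (b - a) * m
r+b*m≡r+a*m+[b-a]*m = solve-∀

i+k*m+k*[-m]≡i : ∀ i k m → i + k * m + k * - m ≡ i
i+k*m+k*[-m]≡i = solve-∀

i+k*[-m]+k*m≡i : ∀ i k m → i + k * - m + k * m ≡ i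
i+k*[-m]+k*m≡i = solve-∀

i<i+1 : ∀ i → i < i + + 1
i<i+1 i = subst (_< i + + 1) (ℤP.+-identityʳ i) (ℤP.+-monoʳ-< i (ℤ.+<+ (ℕ.s≤s ℕ.z≤n)))

i-1<i : ∀ i → i - + 1 < i
i-1<i i = subst (i - + 1 <_) (ℤP.+-identityʳ i) (ℤP.+-monoʳ-< i ℤ.-<+)

¬i<j<i+1 : ∀ {i j} → ¬ (i < j × j < i + + 1)
¬i<j<i+1 {i} {j} (i<j , j<i+1) =
  ℤP.<-irrefl refl (ℤP.<-≤-trans j<i+1 (subst (ℤ._≤ j) (ℤP.+-comm (+ 1) i) (ℤP.i<j⇒suc[i]≤j i<j)))

-- Residues modulo n and Coxeter elements

module _ (n : ℕ) .{{_ : NonZero n}} where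

  r+k*n<r′+k′*n : ∀ {r r′ k k′} → r ℕ.< n → k < k′ → + r + k * + n < + r′ + k′ * + n
  r+k*n<r′+k′*n {r} {r′} {k} {k′} r<n k<k′ = begin-strict
    + r + k * + n   <⟨ ℤP.+-monoˡ-< (k * + n) (ℤ.+<+ r<n) ⟩
    + n + k * + n   ≡⟨ ℤP.suc-* k (+ n) ⟨
    ℤ.suc k * + n   ≤⟨ ℤP.*-monoʳ-≤-nonNeg (+ n) (ℤP.i<j⇒suc[i]≤j k<k′) ⟩
    k′ * + n        ≤⟨ ℤP.i≤j+i (k′ * + n) (+ r′) ⟩
    + r′ + k′ * + n ∎
    where open ℤP.≤-Reasoning

  %ℕ-unique : ∀ x {r} k → r ℕ.< n → x ≡ + r + k * + n → x %ℕ n ≡ r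
  %ℕ-unique x {r} k r<n x≡ with ℤP.<-cmp k (x /ℕ n)
  ... | tri< k<q _ _ = ⊥-elim (ℤP.<-irrefl (trans (sym x≡) x≡r′+q*n) (r+k*n<r′+k′*n r<n k<q))
    where x≡r′+q*n = a≡a%ℕn+[a/ℕn]*n x n
  ... | tri> _ _ q<k = ⊥-elim (ℤP.<-irrefl (trans (sym x≡r′+q*n) x≡) (r+k*n<r′+k′*n (n%ℕd<d x n) q<k))
    where x≡r′+q*n = a≡a%ℕn+[a/ℕn]*n x n
  ... | tri≈ _ refl _ = ℤP.+-injective (∙-cancelʳ (k * + n) _ _ (trans (sym (a≡a%ℕn+[a/ℕn]*n x n)) x≡))

  %ℕ-+n : ∀ x → (x + + n) %ℕ n ≡ x %ℕ n
  %ℕ-+n x = %ℕ-unique (x + + n) (+ 1 + x /ℕ n) (n%ℕd<d x n) (begin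
    x + + n                                   ≡⟨ cong (_+ + n) (a≡a%ℕn+[a/ℕn]*n x n) ⟩
    + (x %ℕ n) + (x /ℕ n) * + n + + n         ≡⟨ r+q*m+m≡r+[1+q]*m (+ (x %ℕ n)) (x /ℕ n) (+ n) ⟩
    + (x %ℕ n) + (+ 1 + x /ℕ n) * + n         ∎)
    where open ≡-Reasoning

  %ℕ--n : ∀ x → (x - + n) %ℕ n ≡ x %ℕ n
  %ℕ--n x = trans (sym (%ℕ-+n (x - + n))) (cong (_%ℕ n) ([i-k]+k≡i x (+ n)))

  suc≡n⇒%≡0 : ∀ {u} → suc u ≡ n → suc u ℕ.% n ≡ 0
  suc≡n⇒%≡0 1+u≡n = trans (cong (ℕ._% n) 1+u≡n) (ℕD.n%n≡0 n)

  %ℕ-+1 : ∀ x → (x + + 1) %ℕ n ≡ suc (x %ℕ n) ℕ.% n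
  %ℕ-+1 x = [ no-wrap , wrap ]′ (ℕP.m≤n⇒m<n∨m≡n (n%ℕd<d x n))
    where
    r = x %ℕ n
    k = x /ℕ n
    x+1≡ : x + + 1 ≡ + suc r + k * + n
    x+1≡ = trans (cong (_+ + 1) (a≡a%ℕn+[a/ℕn]*n x n)) (r+q*m+1≡[1+r]+q*m (+ r) k (+ n))
    no-wrap : suc r ℕ.< n → (x + + 1) %ℕ n ≡ suc r ℕ.% n
    no-wrap 1+r<n = trans (%ℕ-unique (x + + 1) k 1+r<n x+1≡) (sym (ℕD.m<n⇒m%n≡m 1+r<n))
    wrap : suc r ≡ n → (x + + 1) %ℕ n ≡ suc r ℕ.% n
    wrap 1+r≡n = begin
      (x + + 1) %ℕ n ≡⟨ %ℕ-unique (x + + 1) (+ 1 + k) (ℕ.>-nonZero⁻¹ n) x+1≡0+[1+k]*n ⟩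
      0              ≡⟨ suc≡n⇒%≡0 1+r≡n ⟨
      suc r ℕ.% n    ∎
      where
      open ≡-Reasoning
      x+1≡0+[1+k]*n = trans x+1≡ (trans (cong (λ m → + m + k * + n) 1+r≡n) (m+q*m≡0+[1+q]*m k (+ n)))

  suc%-injective : ∀ {u v} → u ℕ.< n → v ℕ.< n → suc u ℕ.% n ≡ suc v ℕ.% n → u ≡ v
  suc%-injective {u} {v} u<n v<n eq with ℕP.m≤n⇒m<n∨m≡n u<n | ℕP.m≤n⇒m<n∨m≡n v<n
  ... | inj₁ 1+u<n | inj₁ 1+v<n = ℕP.suc-injective (begin
    suc u          ≡⟨ ℕD.m<n⇒m%n≡m 1+u<n ⟨
    suc u ℕ.% n    ≡⟨ eq ⟩
    suc v ℕ.% n    ≡⟨ ℕD.m<n⇒m%n≡m 1+v<n ⟩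
    suc v          ∎)
    where open ≡-Reasoning
  ... | inj₁ 1+u<n | inj₂ 1+v≡n = ⊥-elim (ℕP.1+n≢0 (trans (sym (ℕD.m<n⇒m%n≡m 1+u<n)) (trans eq (suc≡n⇒%≡0 1+v≡n))))
  ... | inj₂ 1+u≡n | inj₁ 1+v<n = ⊥-elim (ℕP.1+n≢0 (trans (sym (ℕD.m<n⇒m%n≡m 1+v<n)) (trans (sym eq) (suc≡n⇒%≡0 1+u≡n))))
  ... | inj₂ 1+u≡n | inj₂ 1+v≡n = ℕP.suc-injective (trans 1+u≡n (sym 1+v≡n))

  congruent-<⇒+multiple : ∀ {x y} → x %ℕ n ≡ y %ℕ n → x < y → ∃ λ m → y ≡ x + + suc m * + n
  congruent-<⇒+multiple {x} {y} x≡y x<y = positive (y /ℕ n - x /ℕ n) y≡x+K*n (subst (x <_) y≡x+K*n x<y)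
    where
    y≡x+K*n : y ≡ x + (y /ℕ n - x /ℕ n) * + n
    y≡x+K*n = begin
      y                                                   ≡⟨ a≡a%ℕn+[a/ℕn]*n y n ⟩
      + (y %ℕ n) + y /ℕ n * + n                           ≡⟨ cong (λ r → + r + y /ℕ n * + n) x≡y ⟨
      + (x %ℕ n) + y /ℕ n * + n                           ≡⟨ r+b*m≡r+a*m+[b-a]*m (+ (x %ℕ n)) (x /ℕ n) (y /ℕ n) (+ n) ⟩
      + (x %ℕ n) + x /ℕ n * + n + (y /ℕ n - x /ℕ n) * + n ≡⟨ cong (_+ (y /ℕ n - x /ℕ n) * + n) (a≡a%ℕn+[a/ℕn]*n x n) ⟨
      x + (y /ℕ n - x /ℕ n) * + n                         ∎
      where open ≡-Reasoning
    positive : ∀ K → y ≡ x + K * + n → x < x + K * + n → ∃ λ m → y ≡ x + + suc m * + n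
    positive (+ suc m) y≡ _      = m , y≡
    positive (+ zero)  _  x<x+0 = ⊥-elim (ℤP.<-irrefl (sym (ℤP.+-identityʳ x)) x<x+0)
    positive -[1+ m ]  _  x<x+K*n = ⊥-elim (ℤP.<-irrefl refl (ℤP.<-≤-trans x<x+K*n (begin
      x + -[1+ m ] * + n ≤⟨ ℤP.+-monoʳ-≤ x (ℤP.*-monoʳ-≤-nonNeg (+ n) (ℤ.-≤+ {m} {0})) ⟩
      x + + 0            ≡⟨ ℤP.+-identityʳ x ⟩
      x                  ∎)))
      where open ℤP.≤-Reasoning

  Periodic : (ℤ → Set) → Set
  Periodic P = (∀ {x} → P x → P (x + + n)) × (∀ {x} → P x → P (x - + n))

  displacement : ℕ → Fin n → ℤ
  displacement r i with r ℕ.≟ toℕ i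
  ... | yes _ = + 1
  ... | no _ with r ℕ.≟ suc (toℕ i) ℕ.% n
  ...   | yes _ = - + 1
  ...   | no _ = + 0

  s≡+displacement : ∀ i y → s n i y ≡ y + displacement (y %ℕ n) i
  s≡+displacement i y with y %ℕ n ℕ.≟ toℕ i
  ... | yes _ = refl
  ... | no _ with y %ℕ n ℕ.≟ suc (toℕ i) ℕ.% n
  ...   | yes _ = refl
  ...   | no _ = sym (ℤP.+-identityʳ y)

  s-+n : ∀ i y → s n i (y + + n) ≡ s n i y + + n
  s-+n i y = begin
    s n i (y + + n)                              ≡⟨ s≡+displacement i (y + + n) ⟩
    y + + n + displacement ((y + + n) %ℕ n) i    ≡⟨ cong (λ r → y + + n + displacement r i) (%ℕ-+n y) ⟩
    y + + n + displacement (y %ℕ n) i            ≡⟨ i+j+k≡i+k+j y (+ n) _ ⟩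
    y + displacement (y %ℕ n) i + + n            ≡⟨ cong (_+ + n) (s≡+displacement i y) ⟨
    s n i y + + n                                ∎
    where open ≡-Reasoning

  prod-+n : ∀ w y → prod n w (y + + n) ≡ prod n w y + + n
  prod-+n []      y = refl
  prod-+n (i ∷ w) y = trans (cong (s n i) (prod-+n w y)) (s-+n i (prod n w y))

  prod--n : ∀ w y → prod n w (y - + n) ≡ prod n w y - + n
  prod--n w y = begin
    prod n w (y - + n)             ≡⟨ [i+k]-k≡i _ (+ n) ⟨
    prod n w (y - + n) + + n - + n ≡⟨ cong (_- + n) (prod-+n w (y - + n)) ⟨
    prod n w (y - + n + + n) - + n ≡⟨ cong (λ z → prod n w z - + n) ([i-k]+k≡i y (+ n)) ⟩
    prod n w y - + n               ∎
    where open ≡-Reasoning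

  Lc-periodic : ∀ w → Periodic (Lc n w)
  Lc-periodic w = (λ {y} y<c[y] → subst (y + + n <_) (sym (prod-+n w y)) (ℤP.+-monoˡ-< (+ n) y<c[y]))
                , (λ {y} y<c[y] → subst (y - + n <_) (sym (prod--n w y)) (ℤP.+-monoˡ-< (- + n) y<c[y]))

  Rc-periodic : ∀ w → Periodic (Rc n w)
  Rc-periodic w = (λ {y} c[y]<y → subst (_< y + + n) (sym (prod-+n w y)) (ℤP.+-monoˡ-< (+ n) c[y]<y))
                , (λ {y} c[y]<y → subst (_< y - + n) (sym (prod--n w y)) (ℤP.+-monoˡ-< (- + n) c[y]<y))

  data SimpleStep (i : Fin n) (y : ℤ) : ℤ → Set where
    raises : y %ℕ n ≡ toℕ i → SimpleStep i y (y + + 1)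
    lowers : y %ℕ n ≡ suc (toℕ i) ℕ.% n → SimpleStep i y (y - + 1)
    fixes  : y %ℕ n ≢ toℕ i → SimpleStep i y y

  simpleStep : ∀ i y → SimpleStep i y (s n i y)
  simpleStep i y with y %ℕ n ℕ.≟ toℕ i
  ... | yes e = raises e
  ... | no ne with y %ℕ n ℕ.≟ suc (toℕ i) ℕ.% n
  ...   | yes e = lowers e
  ...   | no _ = fixes ne

  module Trajectory (x : ℤ) where

    raiser lowerer : Fin n
    raiser  = fromℕ< (n%ℕd<d x n)
    lowerer = fromℕ< (n%ℕd<d (x - + 1) n)

    raises-x⇒raiser : ∀ {a} → x %ℕ n ≡ toℕ a → raiser ≡ a
    raises-x⇒raiser e = FinP.toℕ-injective (trans (FinP.toℕ-fromℕ< _) e)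

    raises-x-1⇒lowerer : ∀ {a} → (x - + 1) %ℕ n ≡ toℕ a → lowerer ≡ a
    raises-x-1⇒lowerer e = FinP.toℕ-injective (trans (FinP.toℕ-fromℕ< _) e)

    lowers-x+1⇒raiser : ∀ {a} → (x + + 1) %ℕ n ≡ suc (toℕ a) ℕ.% n → raiser ≡ a
    lowers-x+1⇒raiser e = raises-x⇒raiser (suc%-injective (n%ℕd<d x n) (FinP.toℕ<n _) (trans (sym (%ℕ-+1 x)) e))

    lowers-x⇒lowerer : ∀ {a} → x %ℕ n ≡ suc (toℕ a) ℕ.% n → lowerer ≡ a
    lowers-x⇒lowerer {a} e = raises-x-1⇒lowerer (suc%-injective (n%ℕd<d (x - + 1) n) (FinP.toℕ<n a) (begin
      suc ((x - + 1) %ℕ n) ℕ.% n ≡⟨ %ℕ-+1 (x - + 1) ⟨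
      (x - + 1 + + 1) %ℕ n       ≡⟨ cong (_%ℕ n) ([i-k]+k≡i x (+ 1)) ⟩
      x %ℕ n                     ≡⟨ e ⟩
      suc (toℕ a) ℕ.% n          ∎))
      where open ≡-Reasoning

    -- Under distinct simple generators, x can only leave through s_raiser or s_lowerer
    -- and could only come back through the generator it left by, which is used up.
    Tracked : List (Fin n) → ℤ → Set
    Tracked u y = (y ≡ x × raiser ∉ u) ⊎ (x < y × raiser ∈ u) ⊎ (y < x × lowerer ∈ u)

    tracked-step : ∀ {a u y z} → a ∉ u → Tracked u y → SimpleStep a y z → Tracked (a ∷ u) z
    tracked-step _ (inj₁ (refl , _)) (raises e) = inj₂ (inj₁ (i<i+1 x , here (raises-x⇒raiser e)))
    tracked-step _ (inj₁ (refl , _)) (lowers e) = inj₂ (inj₂ (i-1<i x , here (lowers-x⇒lowerer e)))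
    tracked-step _ (inj₁ (refl , r∉u)) (fixes ne) =
      inj₁ (refl , λ { (here r≡a) → ne (trans (sym (FinP.toℕ-fromℕ< _)) (cong toℕ r≡a))
                     ; (there r∈u) → r∉u r∈u })
    tracked-step _ (inj₂ (inj₁ (x<y , r∈u))) (raises _) = inj₂ (inj₁ (ℤP.<-trans x<y (i<i+1 _) , there r∈u))
    tracked-step {y = y} a∉u (inj₂ (inj₁ (x<y , r∈u))) (lowers e) with ℤP.<-cmp x (y - + 1)
    ... | tri< x<y-1 _ _ = inj₂ (inj₁ (x<y-1 , there r∈u))
    ... | tri≈ _ x≡y-1 _ = ⊥-elim (a∉u (subst (_∈ _) (lowers-x+1⇒raiser (begin
      (x + + 1) %ℕ n         ≡⟨ cong (λ t → (t + + 1) %ℕ n) x≡y-1 ⟩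
      (y - + 1 + + 1) %ℕ n   ≡⟨ cong (_%ℕ n) ([i-k]+k≡i y (+ 1)) ⟩
      y %ℕ n                 ≡⟨ e ⟩
      _                      ∎)) r∈u))
      where open ≡-Reasoning
    ... | tri> _ _ y-1<x = ⊥-elim (¬i<j<i+1 (y-1<x , subst (x <_) (sym ([i-k]+k≡i y (+ 1))) x<y))
    tracked-step _ (inj₂ (inj₁ (x<y , r∈u))) (fixes _) = inj₂ (inj₁ (x<y , there r∈u))
    tracked-step {y = y} a∉u (inj₂ (inj₂ (y<x , l∈u))) (raises e) with ℤP.<-cmp (y + + 1) x
    ... | tri< y+1<x _ _ = inj₂ (inj₂ (y+1<x , there l∈u))
    ... | tri≈ _ y+1≡x _ = ⊥-elim (a∉u (subst (_∈ _) (raises-x-1⇒lowerer (begin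
      (x - + 1) %ℕ n         ≡⟨ cong (λ t → (t - + 1) %ℕ n) y+1≡x ⟨
      (y + + 1 - + 1) %ℕ n   ≡⟨ cong (_%ℕ n) ([i+k]-k≡i y (+ 1)) ⟩
      y %ℕ n                 ≡⟨ e ⟩
      _                      ∎)) l∈u))
      where open ≡-Reasoning
    ... | tri> _ _ x<y+1 = ⊥-elim (¬i<j<i+1 (y<x , x<y+1))
    tracked-step _ (inj₂ (inj₂ (y<x , l∈u))) (lowers _) = inj₂ (inj₂ (ℤP.<-trans (i-1<i _) y<x , there l∈u))
    tracked-step _ (inj₂ (inj₂ (y<x , l∈u))) (fixes _) = inj₂ (inj₂ (y<x , there l∈u))

    tracked : ∀ u → Unique u → Tracked u (prod n u x)
    tracked []      []           = inj₁ (refl , λ ())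
    tracked (a ∷ u) (a∉u ∷ u!)   = tracked-step (All¬⇒¬Any a∉u) (tracked u u!) (simpleStep a (prod n u x))

  coxeter-moves : ∀ {w} → w ↭ allFin n → ∀ x → Lc n w x ⊎ Rc n w x
  coxeter-moves {w} w↭ x with Trajectory.tracked x w w-unique
    where
    w-unique : Unique w
    w-unique = Unique-resp-↭ (≡.setoid (Fin n)) (↭⇒↭ₛ (↭-sym w↭)) (allFin⁺ n)
  ... | inj₁ (_ , r∉w)           = ⊥-elim (r∉w (∈-resp-↭ (↭-sym w↭) (∈-allFin _)))
  ... | inj₂ (inj₁ (x<c[x] , _)) = inj₁ x<c[x]
  ... | inj₂ (inj₂ (c[x]<x , _)) = inj₂ c[x]<x

ShiftInvariant : ℤ → (ℤ → ℤ → Set) → Set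
ShiftInvariant k Q = ∀ x y → Q x y ⇔ Q (x + k) (y + k)

module _ {k : ℤ} {Q : ℤ → ℤ → Set} (Q-inv : ShiftInvariant k Q) where

  transposeʳ : ∀ {a i} → Q a (i - k) ⇔ Q (a + k) i
  transposeʳ {a} {i} = mk⇔
    (λ h → subst (Q (a + k)) ([i-k]+k≡i i k) (Equivalence.to (Q-inv a (i - k)) h))
    (λ h → Equivalence.from (Q-inv a (i - k)) (subst (Q (a + k)) (sym ([i-k]+k≡i i k)) h))

  transposeˡ : ∀ {i b} → Q (i - k) b ⇔ Q i (b + k)
  transposeˡ {i} {b} = mk⇔
    (λ h → subst (λ j → Q j (b + k)) ([i-k]+k≡i i k) (Equivalence.to (Q-inv (i - k) b) h))
    (λ h → Equivalence.from (Q-inv (i - k) b) (subst (λ j → Q j (b + k)) (sym ([i-k]+k≡i i k)) h))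

<-shiftInvariant : ∀ k → ShiftInvariant k _<_
<-shiftInvariant k x y = mk⇔ (ℤP.+-monoˡ-< k)
  (λ h → subst₂ _<_ ([i+k]-k≡i x k) ([i+k]-k≡i y k) (ℤP.+-monoˡ-< (- k) h))

module _ {d : ℤ} {R : ℤ → ℤ → Set} (R-shift : ∀ {x y} → R x y → R (x + d) (y + d)) where

  shift-multiple₂ : ∀ k {x y} → R x y → R (x + + k * d) (y + + k * d)
  shift-multiple₂ zero    {x} {y} Rxy = subst₂ R (sym (ℤP.+-identityʳ x)) (sym (ℤP.+-identityʳ y)) Rxy
  shift-multiple₂ (suc k) {x} {y} Rxy =
    subst₂ R (r+q*m+m≡r+[1+q]*m x (+ k) d) (r+q*m+m≡r+[1+q]*m y (+ k) d) (R-shift (shift-multiple₂ k Rxy))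

  shift-multiple-descends : (∀ {x y z} → R x y → R y z → R x z)
                          → ∀ {x} → R (x + d) x → ∀ k → R (x + + suc k * d) x
  shift-multiple-descends R-trans {x} Rx+d,x zero = subst (λ e → R (x + e) x) (sym (ℤP.*-identityˡ d)) Rx+d,x
  shift-multiple-descends R-trans {x} Rx+d,x (suc k) =
    R-trans (subst (λ e → R e (x + + suc k * d)) (i+m+q*m≡i+[1+q]*m x (+ suc k) d) (shift-multiple₂ (suc k) Rx+d,x))
            (shift-multiple-descends R-trans Rx+d,x k)

shift-multiple : ∀ {d} {P : ℤ → Set} → (∀ {x} → P x → P (x + d)) → ∀ k {x} → P x → P (x + + k * d)
shift-multiple {P = P} P-shift k = shift-multiple₂ {R = λ x _ → P x} P-shift k {y = + 0}

-- Increasing sequences and orbits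

pigeonhole-∈ : ∀ {A : Set} (l : List A) (f : Fin (suc (length l)) → A)
             → (∀ {i j} → i Fin.< j → f i ≢ f j) → ¬ (∀ i → f i ∈ l)
pigeonhole-∈ l f distinct f∈l with FinP.pigeonhole (ℕP.n<1+n (length l)) (Any.index ∘ f∈l)
... | i , j , i<j , same-index = distinct i<j (begin
  f i                              ≡⟨ lookup-index (f∈l i) ⟩
  lookup l (Any.index (f∈l i))     ≡⟨ cong (lookup l) same-index ⟩
  lookup l (Any.index (f∈l j))     ≡⟨ lookup-index (f∈l j) ⟨
  f j                              ∎)
  where open ≡-Reasoning

module Increasing {A : Set} {_<_ : A → A → Set} (sto : IsStrictTotalOrder _≡_ _<_)
                  {g : ℕ → A} (g-inc : ∀ t → g t < g (suc t)) where

  open IsStrictTotalOrder sto using (compare; irrefl) renaming (trans to <-trans)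

  <-mono : ∀ {i j} → i ℕ.< j → g i < g j
  <-mono {i} {suc j} i<1+j with ℕP.m≤n⇒m<n∨m≡n (ℕ.s≤s⁻¹ i<1+j)
  ... | inj₁ i<j  = <-trans (<-mono i<j) (g-inc j)
  ... | inj₂ refl = g-inc i

  overtakes : ∀ b → ¬ (b < g 0) → (l : List A) → (∀ z → g 0 < z → z < b → z ∈ l)
            → ∃ λ t → ¬ (b < g t) × b < g (suc t)
  overtakes b b≮g₀ l between⊆l = [ id , stays-below ]′ (search (suc (suc (length l))))
    where
    search : ∀ k → (∃ λ t → ¬ (b < g t) × b < g (suc t)) ⊎ ¬ (b < g k)
    search zero = inj₂ b≮g₀
    search (suc k) with search k
    ... | inj₁ found = inj₁ found
    ... | inj₂ b≮gk with compare b (g (suc k))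
    ...   | tri< b<g₁₊ₖ _ _ = inj₁ (k , b≮gk , b<g₁₊ₖ)
    ...   | tri≈ b≮g₁₊ₖ _ _ = inj₂ b≮g₁₊ₖ
    ...   | tri> b≮g₁₊ₖ _ _ = inj₂ b≮g₁₊ₖ
    below : ∀ {x y} → x < y → ¬ (b < y) → x < b
    below {x} {y} x<y b≮y with compare x b
    ... | tri< x<b _ _ = x<b
    ... | tri≈ _ refl _ = ⊥-elim (b≮y x<y)
    ... | tri> _ _ b<x = ⊥-elim (b≮y (<-trans b<x x<y))
    -- Otherwise g 1, …, g (1 + length l) all lie strictly between g 0 and b, hence in l.
    stays-below : ¬ (b < g (suc (suc (length l)))) → ∃ λ t → ¬ (b < g t) × b < g (suc t)
    stays-below b≮g = ⊥-elim (pigeonhole-∈ l (g ∘ suc ∘ toℕ)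
      (λ i<j gi≡gj → irrefl gi≡gj (<-mono (ℕ.s≤s i<j)))
      (λ i → between⊆l _ (<-mono (ℕ.s≤s ℕ.z≤n)) (below (<-mono (ℕ.s≤s (ℕ.s≤s (FinP.toℕ≤pred[n] i)))) b≮g)))

orbit : ∀ {A : Set} → (A → A) → A → ℕ → A
orbit f y zero    = y
orbit f y (suc k) = f (orbit f y k)

orbit-preserves : ∀ {A : Set} {P : A → Set} (f : A → A) → (∀ {x} → P x → P (f x))
                → ∀ {y} → P y → ∀ k → P (orbit f y k)
orbit-preserves f P-f Py zero    = Py
orbit-preserves {P = P} f P-f Py (suc k) = P-f (orbit-preserves {P = P} f P-f Py k)

orbit-increasing : ∀ {A : Set} {R : A → A → Set} (f : A → A) → (∀ {x y} → R x y → R (f x) (f y))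
                 → ∀ {y} → R y (f y) → ∀ k → R (orbit f y k) (orbit f y (suc k))
orbit-increasing f f-mono Ry zero    = Ry
orbit-increasing {R = R} f f-mono Ry (suc k) = f-mono (orbit-increasing {R = R} f f-mono Ry k)

-- Covers, blocks and ncad of a strict total order on ℤ

module _ {_≺_ : ℤ → ℤ → Set} (≺-sto : IsStrictTotalOrder _≡_ _≺_) where

  open IsStrictTotalOrder ≺-sto using (compare) renaming (trans to ≺-trans; asym to ≺-asym; irrefl to ≺-irrefl)

  cover-unique-lower : ∀ {a b c} → Cover _≺_ a c → Cover _≺_ b c → a ≡ b
  cover-unique-lower {a} {b} (a≺c , a⋖c) (b≺c , b⋖c) with compare a b
  ... | tri< a≺b _ _ = ⊥-elim (a⋖c b (a≺b , b≺c))
  ... | tri≈ _ a≡b _ = a≡b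
  ... | tri> _ _ b≺a = ⊥-elim (b⋖c a (b≺a , a≺c))

  cover-unique-upper : ∀ {a b c} → Cover _≺_ a b → Cover _≺_ a c → b ≡ c
  cover-unique-upper {a} {b} {c} (a≺b , a⋖b) (a≺c , a⋖c) with compare b c
  ... | tri< b≺c _ _ = ⊥-elim (a⋖c b (a≺b , b≺c))
  ... | tri≈ _ b≡c _ = b≡c
  ... | tri> _ _ c≺b = ⊥-elim (a⋖b c (a≺c , c≺b))

  covers-not-nested : ∀ {q p q′ p′} → Cover _≺_ q p → Cover _≺_ q′ p′ → p′ ≺ p → q ≺ q′ → ⊥
  covers-not-nested (_ , q⋖p) (q′≺p′ , _) p′≺p q≺q′ = q⋖p _ (≺-trans q≺q′ q′≺p′ , p′≺p)

  ≮∧≯⇒≡ : ∀ {x y} → ¬ (x ≺ y) → ¬ (y ≺ x) → x ≡ y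
  ≮∧≯⇒≡ {x} {y} x⊀y y⊀x with compare x y
  ... | tri< x≺y _ _ = ⊥-elim (x⊀y x≺y)
  ... | tri≈ _ x≡y _ = x≡y
  ... | tri> _ _ y≺x = ⊥-elim (y⊀x y≺x)

  SameBlock-refl : ∀ x → SameBlock _≺_ x x
  SameBlock-refl x = [] , λ { _ (inj₁ (x≺z , z≺x)) → ⊥-elim (≺-asym x≺z z≺x)
                            ; _ (inj₂ (x≺z , z≺x)) → ⊥-elim (≺-asym x≺z z≺x) }

  SameBlock-sym : ∀ {x y} → SameBlock _≺_ x y → SameBlock _≺_ y x
  SameBlock-sym (l , between⊆l) = l , λ z → between⊆l z ∘ Sum.swap

  SameBlock-trans : ∀ {x y z} → SameBlock _≺_ x y → SameBlock _≺_ y z → SameBlock _≺_ x z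
  SameBlock-trans {x} {y} {z} (l₁ , xy⊆l₁) (l₂ , yz⊆l₂) = l₁ ++ y ∷ l₂ , xz⊆
    where
    xz⊆ : ∀ v → Between _≺_ x z v → v ∈ l₁ ++ y ∷ l₂
    xz⊆ v xzv with compare v y | xzv
    ... | tri≈ _ refl _ | _                 = ∈-++⁺ʳ l₁ (here refl)
    ... | tri< v≺y _ _ | inj₁ (x≺v , _)    = ∈-++⁺ˡ (xy⊆l₁ v (inj₁ (x≺v , v≺y)))
    ... | tri< v≺y _ _ | inj₂ (z≺v , _)    = ∈-++⁺ʳ l₁ (there (yz⊆l₂ v (inj₂ (z≺v , v≺y))))
    ... | tri> _ _ y≺v | inj₁ (_ , v≺z)    = ∈-++⁺ʳ l₁ (there (yz⊆l₂ v (inj₁ (y≺v , v≺z))))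
    ... | tri> _ _ y≺v | inj₂ (_ , v≺x)    = ∈-++⁺ˡ (xy⊆l₁ v (inj₂ (y≺v , v≺x)))

  module CoverChain {f : ℕ → ℤ} (f-covers : ∀ t → Cover _≺_ (f (suc t)) (f t)) where

    descends : ∀ {i j} → i ℕ.< j → f j ≺ f i
    descends = Increasing.<-mono (Flip.isStrictTotalOrder ≺-sto) (proj₁ ∘ f-covers)

    window : ∀ {i j} → i ≤′ j → ∀ {z} → ¬ (f i ≺ z) → ¬ (z ≺ f j) → ∃ λ t → t ≤ j × z ≡ f t
    window ≤′-refl fi⊀z z⊀fi = _ , ℕP.≤-refl , ≮∧≯⇒≡ z⊀fi fi⊀z
    window (≤′-step {j} i≤′j) {z} fi⊀z z⊀f₁₊ⱼ with compare z (f j)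
    ... | tri< z≺fj _ _ = suc j , ℕP.≤-refl , ≮∧≯⇒≡ z⊀f₁₊ⱼ (λ f₁₊ⱼ≺z → proj₂ (f-covers j) z (f₁₊ⱼ≺z , z≺fj))
    ... | tri≈ _ z≡fj _ = j , ℕP.n≤1+n j , z≡fj
    ... | tri> _ _ fj≺z = Product.map₂ (Product.map₁ ℕP.m≤n⇒m≤1+n) (window i≤′j fi⊀z (≺-asym fj≺z))

  module OrderAutomorphism {T T⁻ : ℤ → ℤ} (T-mono : ∀ {x y} → x ≺ y → T x ≺ T y)
                           (T∘T⁻ : ∀ x → T (T⁻ x) ≡ x) (T⁻∘T : ∀ x → T⁻ (T x) ≡ x) where

    T⁻-mono : ∀ {x y} → x ≺ y → T⁻ x ≺ T⁻ y
    T⁻-mono {x} {y} x≺y with compare (T⁻ x) (T⁻ y)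
    ... | tri< T⁻x≺T⁻y _ _ = T⁻x≺T⁻y
    ... | tri≈ _ T⁻x≡T⁻y _ = ⊥-elim (≺-irrefl (trans (sym (T∘T⁻ x)) (trans (cong T T⁻x≡T⁻y) (T∘T⁻ y))) x≺y)
    ... | tri> _ _ T⁻y≺T⁻x = ⊥-elim (≺-asym x≺y (subst₂ _≺_ (T∘T⁻ y) (T∘T⁻ x) (T-mono T⁻y≺T⁻x)))

    T-reflects : ∀ {x y} → T x ≺ T y → x ≺ y
    T-reflects {x} {y} Tx≺Ty = subst₂ _≺_ (T⁻∘T x) (T⁻∘T y) (T⁻-mono Tx≺Ty)

    module _ {P : ℤ → Set} (P-T : ∀ {x} → P x → P (T x)) (P-T⁻ : ∀ {x} → P x → P (T⁻ x))
             (a : ℤ) {y : ℤ} (Py : P y) (Ty≺y : T y ≺ y) (y~a : SameBlock _≺_ y a) where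

      ascends-into-window : ¬ (a ≺ y) → ∃ λ z → P z × ¬ (a ≺ z) × ¬ (z ≺ T a)
      ascends-into-window a⊀y =
        let t , a⊀gₜ , a≺gₜ₊₁ = Increasing.overtakes ≺-sto g-increasing a a⊀y (proj₁ y~a)
                                   (λ z y≺z z≺a → proj₂ y~a z (inj₁ (y≺z , z≺a)))
        in  orbit T⁻ y t , orbit-preserves {P = P} T⁻ P-T⁻ Py t , a⊀gₜ
          , λ gₜ≺Ta → ≺-asym gₜ≺Ta (subst (T a ≺_) (T∘T⁻ _) (T-mono a≺gₜ₊₁))
        where
        g-increasing : ∀ k → orbit T⁻ y k ≺ orbit T⁻ y (suc k)
        g-increasing = orbit-increasing {R = _≺_} T⁻ T⁻-mono (subst (_≺ T⁻ y) (T⁻∘T y) (T⁻-mono Ty≺y))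

      descends-into-window : a ≺ y → ∃ λ z → P z × ¬ (a ≺ z) × ¬ (z ≺ T a)
      descends-into-window a≺y =
        let t , hₜ⊀a , hₜ₊₁≺a = Increasing.overtakes (Flip.isStrictTotalOrder ≺-sto) h-increasing a
                                   (≺-asym a≺y) (proj₁ y~a) (λ z z≺y a≺z → proj₂ y~a z (inj₂ (a≺z , z≺y)))
        in  orbit T y (suc t) , orbit-preserves {P = P} T P-T Py (suc t) , (λ a≺hₜ₊₁ → ≺-asym a≺hₜ₊₁ hₜ₊₁≺a)
          , λ hₜ₊₁≺Ta → hₜ⊀a (T-reflects hₜ₊₁≺Ta)
        where
        h-increasing : ∀ k → orbit T y (suc k) ≺ orbit T y k
        h-increasing = orbit-increasing {R = flip _≺_} T T-mono Ty≺y

      orbit-meets-window : ∃ λ z → P z × ¬ (a ≺ z) × ¬ (z ≺ T a)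
      orbit-meets-window with compare a y
      ... | tri< a≺y _ _ = descends-into-window a≺y
      ... | tri≈ a⊀y _ _ = ascends-into-window a⊀y
      ... | tri> a⊀y _ _ = ascends-into-window a⊀y

  module _ {n : ℕ} .{{_ : NonZero n}} where

    ncad-cover : ∀ {α} → ncad n _≺_ α → Cover _≺_ (q α) (p α)
    ncad-cover (_ , _ , q⋖p , _) = q⋖p

    ncad-L : ∀ {α i} → ncad n _≺_ α → L α i → p α < i × i < q α × i ≺ q α
    ncad-L (_ , _ , _ , L⇔ , _) = proj₁ (L⇔ _)

    ncad-R : ∀ {α i} → ncad n _≺_ α → R α i → p α < i × i < q α × p α ≺ i
    ncad-R (_ , _ , _ , _ , R⇔) = proj₁ (R⇔ _)

    L≺q : ∀ {α i} → ncad n _≺_ α → L α i → i ≺ q α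
    L≺q α∈ = proj₂ ∘ proj₂ ∘ ncad-L α∈

    p≺R : ∀ {α i} → ncad n _≺_ α → R α i → p α ≺ i
    p≺R α∈ = proj₂ ∘ proj₂ ∘ ncad-R α∈

    ncad⇒IsArc : ∀ {α} → ncad n _≺_ α → IsArc n α
    ncad⇒IsArc {α} α∈@(p<q , p≢q , (q≺p , q⋖p) , L⇔ , R⇔) =
        p<q , p≢q
      , (λ i → bounds ∘ proj₁ (L⇔ i)) , (λ i → bounds ∘ proj₁ (R⇔ i))
      , L⊎R
      , (λ i Li Ri → ≺-asym q≺p (≺-trans (p≺R α∈ Ri) (L≺q α∈ Li)))
      where
      bounds : ∀ {i} {X : Set} → p α < i × i < q α × X → p α < i × i < q α
      bounds (p<i , i<q , _) = p<i , i<q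
      L⊎R : ∀ i → p α < i → i < q α → L α i ⊎ R α i
      L⊎R i p<i i<q with compare i (q α) | compare (p α) i
      ... | tri< i≺q _ _ | _            = inj₁ (proj₂ (L⇔ i) (p<i , i<q , i≺q))
      ... | _            | tri< p≺i _ _ = inj₂ (proj₂ (R⇔ i) (p<i , i<q , p≺i))
      ... | tri≈ _ refl _ | _           = ⊥-elim (ℤP.<-irrefl refl i<q)
      ... | _ | tri≈ _ refl _           = ⊥-elim (ℤP.<-irrefl refl p<i)
      ... | tri> _ _ q≺i | tri> _ _ i≺p = ⊥-elim (q⋖p i (q≺i , i≺p))

    LeftMeetsRight : Arc → Arc → Set
    LeftMeetsRight α β = (∃ λ i → (L α i ⊎ i ≡ p α ⊎ i ≡ q α) × R β i)
                       ⊎ (∃ λ i → L α i × (i ≡ p β ⊎ i ≡ q β))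

    Crosses⇒meets : ∀ {α β} → Crosses α β → LeftMeetsRight α β × LeftMeetsRight β α
    Crosses⇒meets (α-meets-β , β-meets-α) =
      α-meets-β , Sum.map (Product.map₂ swap) (Product.map₂ swap) β-meets-α

    meets⇒≺ : ∀ {α β} → ncad n _≺_ α → ncad n _≺_ β → LeftMeetsRight α β → p β ≺ p α ⊎ q β ≺ q α
    meets⇒≺ α∈ β∈ (inj₁ (i , inj₁ Lαi , Rβi))         = inj₁ (≺-trans (p≺R β∈ Rβi) (≺-trans (L≺q α∈ Lαi) (proj₁ (ncad-cover α∈))))
    meets⇒≺ α∈ β∈ (inj₁ (i , inj₂ (inj₁ refl) , Rβi)) = inj₁ (p≺R β∈ Rβi)
    meets⇒≺ α∈ β∈ (inj₁ (i , inj₂ (inj₂ refl) , Rβi)) = inj₁ (≺-trans (p≺R β∈ Rβi) (proj₁ (ncad-cover α∈)))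
    meets⇒≺ α∈ β∈ (inj₂ (i , Lαi , inj₁ refl))        = inj₁ (≺-trans (L≺q α∈ Lαi) (proj₁ (ncad-cover α∈)))
    meets⇒≺ α∈ β∈ (inj₂ (i , Lαi , inj₂ refl))        = inj₂ (L≺q α∈ Lαi)

    ncad-noncrossing : ∀ α β → ncad n _≺_ α → ncad n _≺_ β → ¬ Crosses α β
    ncad-noncrossing α β α∈ β∈ c = apart (meets⇒≺ α∈ β∈ (proj₁ meets)) (meets⇒≺ β∈ α∈ (proj₂ meets))
      where
      meets = Crosses⇒meets c
      apart : p β ≺ p α ⊎ q β ≺ q α → p α ≺ p β ⊎ q α ≺ q β → ⊥
      apart (inj₁ pβ≺pα) (inj₁ pα≺pβ) = ≺-asym pβ≺pα pα≺pβ
      apart (inj₂ qβ≺qα) (inj₂ qα≺qβ) = ≺-asym qβ≺qα qα≺qβ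
      apart (inj₁ pβ≺pα) (inj₂ qα≺qβ) = covers-not-nested (ncad-cover α∈) (ncad-cover β∈) pβ≺pα qα≺qβ
      apart (inj₂ qβ≺qα) (inj₁ pα≺pβ) = covers-not-nested (ncad-cover β∈) (ncad-cover α∈) pα≺pβ qβ≺qα

    ncad-ends⇒ArcEq : ∀ {α β} → ncad n _≺_ α → ncad n _≺_ β → p α ≡ p β → q α ≡ q β → ArcEq α β
    ncad-ends⇒ArcEq (_ , _ , _ , Lα⇔ , Rα⇔) (_ , _ , _ , Lβ⇔ , Rβ⇔) refl refl =
      refl , refl , (λ i → same (Lα⇔ i) (Lβ⇔ i)) , (λ i → same (Rα⇔ i) (Rβ⇔ i))
      where
      same : ∀ {A B C : Set} → (A → C) × (C → A) → (B → C) × (C → B) → (A → B) × (B → A)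
      same (A⇒C , C⇒A) (B⇒C , C⇒B) = C⇒B ∘ A⇒C , C⇒A ∘ B⇒C

    ncad-unique-p : ∀ α β → ncad n _≺_ α → ncad n _≺_ β → p α ≡ p β → ArcEq α β
    ncad-unique-p α β α∈ β∈ p≡ = ncad-ends⇒ArcEq α∈ β∈ p≡
      (cover-unique-lower (ncad-cover α∈) (subst (Cover _≺_ (q β)) (sym p≡) (ncad-cover β∈)))

    ncad-unique-q : ∀ α β → ncad n _≺_ α → ncad n _≺_ β → q α ≡ q β → ArcEq α β
    ncad-unique-q α β α∈ β∈ q≡ = ncad-ends⇒ArcEq α∈ β∈
      (cover-unique-upper (ncad-cover α∈) (subst (λ a → Cover _≺_ a (p β)) (sym q≡) (ncad-cover β∈))) q≡

    ncad-shift : ∀ {k} → ShiftInvariant k _≺_ → (∀ x → (x + k) %ℕ n ≡ x %ℕ n)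
               → ∀ {α} → ncad n _≺_ α → ncad n _≺_ (shiftArc k α)
    ncad-shift {k} ≺-inv residue-inv {α} (p<q , p≢q , (q≺p , q⋖p) , L⇔ , R⇔) =
        ℤP.+-monoˡ-< k p<q
      , (λ p+k≡q+k → p≢q (trans (sym (residue-inv (p α))) (trans p+k≡q+k (residue-inv (q α)))))
      , ( Equivalence.to (≺-inv (q α) (p α)) q≺p
        , λ z (q+k≺z , z≺p+k) → q⋖p (z - k) ( Equivalence.from (transposeʳ ≺-inv {q α} {z}) q+k≺z
                                           , Equivalence.from (transposeˡ ≺-inv {z} {p α}) z≺p+k))
      , (λ i → ⇔⇒pair (shifted i (transposeˡ ≺-inv {i} {q α}) ⇔-∘ pair⇒⇔ (L⇔ (i - k))))
      , (λ i → ⇔⇒pair (shifted i (transposeʳ ≺-inv {p α} {i}) ⇔-∘ pair⇒⇔ (R⇔ (i - k))))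
      where
      pair⇒⇔ : ∀ {A B : Set} → (A → B) × (B → A) → A ⇔ B
      pair⇒⇔ (to , from) = mk⇔ to from
      ⇔⇒pair : ∀ {A B : Set} → A ⇔ B → (A → B) × (B → A)
      ⇔⇒pair e = Equivalence.to e , Equivalence.from e
      shifted : ∀ i {X Y : Set} → X ⇔ Y → (p α < i - k × i - k < q α × X) ⇔ (p α + k < i × i < q α + k × Y)
      shifted i X⇔Y = transposeʳ (<-shiftInvariant k) {p α} {i} ×-⇔ transposeˡ (<-shiftInvariant k) {i} {q α} ×-⇔ X⇔Y

  module _ {n : ℕ} .{{_ : NonZero n}} {w : List (Fin n)} (w↭ : w ↭ allFin n)
           (sortable₂ : Sortable2 n w _≺_) where

    ncad-L⊆Lc : ∀ α → ncad n _≺_ α → ∀ i → L α i → Lc n w i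
    ncad-L⊆Lc α α∈ i Li with coxeter-moves n w↭ i
    ... | inj₁ i∈Lc = i∈Lc
    ... | inj₂ i∈Rc = let p<i , i<q , i≺q = ncad-L α∈ Li in
      ⊥-elim (proj₂ sortable₂ (p α , i , q α , p<i , i<q , i≺q , proj₁ (ncad-cover α∈) , i∈Rc))

    ncad-R⊆Rc : ∀ α → ncad n _≺_ α → ∀ i → R α i → Rc n w i
    ncad-R⊆Rc α α∈ i Ri with coxeter-moves n w↭ i
    ... | inj₂ i∈Rc = i∈Rc
    ... | inj₁ i∈Lc = let p<i , i<q , p≺i = ncad-R α∈ Ri in
      ⊥-elim (proj₁ sortable₂ (p α , i , q α , p<i , i<q , proj₁ (ncad-cover α∈) , p≺i , i∈Lc))

  module _ {n : ℕ} .{{_ : NonZero n}} (tito : IsTITO n _≺_) where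
    open IsTITO tito using (shift-inv; shift-inv⁻)

    ≺-+n-invariant : ShiftInvariant (+ n) _≺_
    ≺-+n-invariant x y = mk⇔ (shift-inv x y) (shift-inv⁻ x y)

    ≺--n-invariant : ShiftInvariant (- + n) _≺_
    ≺--n-invariant x y = mk⇔
      (λ x≺y → shift-inv⁻ _ _ (subst₂ _≺_ (sym ([i-k]+k≡i x (+ n))) (sym ([i-k]+k≡i y (+ n))) x≺y))
      (λ h → subst₂ _≺_ ([i-k]+k≡i x (+ n)) ([i-k]+k≡i y (+ n)) (shift-inv _ _ h))

    ncad-isCyclicNCAD : IsCyclicNCAD n (ncad n _≺_)
    ncad-isCyclicNCAD =
        (λ _ → ncad⇒IsArc)
      , (λ _ α∈ → ncad-shift ≺-+n-invariant (%ℕ-+n n) α∈ , ncad-shift ≺--n-invariant (%ℕ--n n) α∈)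
      , ncad-noncrossing
      , ncad-unique-p
      , ncad-unique-q

    module _ (ℓ : Loop (ncad n _≺_)) where

      vertex : ℕ → ℤ
      vertex t = p (seq ℓ (+ t))

      next-vertex : ∀ t → q (seq ℓ (+ t)) ≡ vertex (suc t)
      next-vertex t = trans (link ℓ (+ t)) (cong (λ m → p (seq ℓ (+ m))) (ℕP.+-comm t 1))

      vertex-covers : ∀ t → Cover _≺_ (vertex (suc t)) (vertex t)
      vertex-covers t = subst (λ v → Cover _≺_ v (vertex t)) (next-vertex t) (ncad-cover (mem ℓ (+ t)))

      vertex-increasing : ∀ t → vertex t < vertex (suc t)
      vertex-increasing t = subst (vertex t <_) (next-vertex t) (proj₁ (mem ℓ (+ t)))

      vertex-period : ∃ λ i → ∃ λ j → ∃ λ m → i ℕ.< j × vertex j ≡ vertex i + + suc m * + n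
      vertex-period with FinP.pigeonhole (ℕP.n<1+n n) (λ t → fromℕ< (n%ℕd<d (vertex (toℕ t)) n))
      ... | i , j , i<j , same-residue =
        let m , vⱼ≡ = congruent-<⇒+multiple n (FinP.fromℕ<-injective _ _ _ _ same-residue)
                        (Increasing.<-mono ℤP.<-isStrictTotalOrder vertex-increasing i<j)
        in  toℕ i , toℕ j , m , i<j , vⱼ≡

    module Translation (m : ℕ) where

      T T⁻ : ℤ → ℤ
      T  x = x + + suc m * + n
      T⁻ x = x + + suc m * - + n

      open OrderAutomorphism {T} {T⁻} (shift-multiple₂ {+ n} {_≺_} (shift-inv _ _) (suc m))
        (λ x → i+k*[-m]+k*m≡i x (+ suc m) (+ n)) (λ x → i+k*m+k*[-m]≡i x (+ suc m) (+ n)) public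

      waning⇒T≺ : ∀ {x} → Waning n _≺_ x → T x ≺ x
      waning⇒T≺ wan = shift-multiple-descends {+ n} {_≺_} (shift-inv _ _) ≺-trans wan m

      waxing⇒≺T : ∀ {x} → Waxing n _≺_ x → x ≺ T x
      waxing⇒≺T wax = shift-multiple-descends {+ n} {flip _≺_} (shift-inv _ _) (flip ≺-trans) wax m

    nonwaxing-in-waning-block : ∀ {w} → Sortable1 n w _≺_ → ∀ {v} → ¬ Waxing n _≺_ v
                              → ¬ ¬ (Σ (ThreeBlocks n w _≺_) λ tb → SameBlock _≺_ v (proj₁ tb))
    nonwaxing-in-waning-block (inj₁ (_ , all-waxing)) v-not-waxing _ = v-not-waxing (all-waxing _)
    nonwaxing-in-waning-block (inj₂ tb@(b , _ , _ , _ , before , _ , after , _)) {v} v-not-waxing not-in =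
      ¬¬-excluded-middle λ { (yes v~b) → not-in (tb , v~b) ; (no v≁b) → outside v≁b }
      where
      outside : ¬ SameBlock _≺_ v b → ⊥
      outside v≁b with compare v b
      ... | tri< v≺b _ _ = v-not-waxing (proj₁ (before v v≁b v≺b))
      ... | tri≈ _ refl _ = v≁b (SameBlock-refl v)
      ... | tri> _ _ b≺v = v-not-waxing (proj₁ (after v v≁b b≺v))

    loop-meets : ∀ {w} → Sortable1 n w _≺_ → (P : ℤ → Set) → Decidable P → Periodic n P
               → (∀ (tb : ThreeBlocks n w _≺_) → ∃ λ x → SameBlock _≺_ x (proj₁ tb) × P x)
               → (ℓ : Loop (ncad n _≺_)) → ∃ λ i → P (p (seq ℓ i))
    loop-meets {w} sortable₁ P P? P-periodic P-in-block ℓ with vertex-period ℓ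
    ... | i , j , m , i<j , vⱼ≡Tvᵢ = + proj₁ found , proj₂ (proj₂ found)
      where
      open Translation m
      open CoverChain (vertex-covers ℓ)
      P-T : ∀ {x} → P x → P (T x)
      P-T = shift-multiple {d = + n} {P} (proj₁ P-periodic) (suc m)
      P-T⁻ : ∀ {x} → P x → P (T⁻ x)
      P-T⁻ = shift-multiple {d = - + n} {P} (proj₂ P-periodic) (suc m)
      vᵢ-not-waxing : ¬ Waxing n _≺_ (vertex ℓ i)
      vᵢ-not-waxing wax = ≺-asym (subst (vertex ℓ i ≺_) (sym vⱼ≡Tvᵢ) (waxing⇒≺T wax)) (descends i<j)
      -- Block membership is undecidable, so the vertex is found under ¬¬ and then
      -- recovered by a bounded search.
      meets : ¬ ¬ ∃ λ t → t ℕ.< suc j × P (vertex ℓ t)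
      meets ¬meets = nonwaxing-in-waning-block {w} sortable₁ vᵢ-not-waxing λ (tb , vᵢ~b) →
        let x , x~b , Px = P-in-block tb
            z , Pz , vᵢ⊀z , z⊀Tvᵢ = orbit-meets-window {P = P} P-T P-T⁻ (vertex ℓ i) Px
                                      (waning⇒T≺ (proj₁ (proj₂ tb) x x~b))
                                      (SameBlock-trans x~b (SameBlock-sym vᵢ~b))
            t , t≤j , z≡vₜ = window (ℕP.≤⇒≤′ (ℕP.<⇒≤ i<j)) vᵢ⊀z (subst (λ v → ¬ (z ≺ v)) (sym vⱼ≡Tvᵢ) z⊀Tvᵢ)
        in  ¬meets (t , ℕ.s≤s t≤j , subst P z≡vₜ Pz)
      found : ∃ λ t → t ℕ.< suc j × P (vertex ℓ t)
      found = decidable-stable (anyUpTo? (P? ∘ vertex ℓ) (suc j)) meets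

lemma4p1 : (n : ℕ) .{{_ : NonZero n}} → 2 ≤ n
    → (w : List (Fin n)) → w ↭ allFin n
    → (_≺_ : ℤ → ℤ → Set) → IsTITO n _≺_ → CSortable n w _≺_
    → IsCyclicCNCAD n w (ncad n _≺_)
-- The argument does not use n ≥ 2.
lemma4p1 n _ w w↭ _≺_ tito (sortable₁ , sortable₂) =
    ncad-isCyclicNCAD ≺-sto tito
  , ncad-L⊆Lc ≺-sto w↭ sortable₂
  , ncad-R⊆Rc ≺-sto w↭ sortable₂
  , λ ℓ → Product.map₂ inj₁ (loop-meets ≺-sto tito {w} sortable₁ (Lc n w) (λ x → x ℤP.<? prod n w x)
                               (Lc-periodic n w) (λ (_ , _ , some-Lc , _) → some-Lc) ℓ)
        , Product.map₂ inj₁ (loop-meets ≺-sto tito {w} sortable₁ (Rc n w) (λ x → prod n w x ℤP.<? x)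
                               (Rc-periodic n w) (λ (_ , _ , _ , some-Rc , _) → some-Rc) ℓ)
  where
  ≺-sto = IsTITO.isStrictTotalOrder tito
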